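{- Let $G$ be a graph and $H_0$ an $r$-partite $r$-graph. Suppose $\mathrm{ed}_0: V(G) \to E(H_0)$ is a surjective function such that $\mathrm{ed}_0(u) \cap \mathrm{ed}_0(v) \ne \emptyset$ for every edge $uv \in E(G)$. Then $\mathrm{tc}_r(G) \ge \tau(H_0)$.
   Context: An $r$-graph $H$ is $r$-partite if $V(H)=V_1\sqcup\dots\sqcup V_r$ with $|e\cap V_i|=1$ for all edges $e$ and all $i$. $\tau(H)$ is the minimum size of a set of vertices meeting every edge of $H$. $\mathrm{tc}_r(G)$ is the minimum $m$ such that for every colouring of $E(G)$ with $r$ colours there are $m$ monochromatic connected components (single vertices count as components in each colour) covering $V(G)$. -}

module Defs where

open import Data.Nat using (ℕ; _≤_)
open import Data.Fin using (Fin)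
open import Data.Bool using (Bool; true; false)
open import Data.Product using (Σ; ∃; _×_; _,_; proj₁; proj₂)
open import Relation.Binary.PropositionalEquality using (_≡_)
open import Function.Definitions using (Injective; Surjective)

record Graph (n : ℕ) : Set where
  field
    adj    : Fin n → Fin n → Bool
    sym    : ∀ u v → adj u v ≡ adj v u
    irrefl : ∀ u → adj u u ≡ false
open Graph public

-- An r-partite r-graph on vertex set Fin N with k edges.
-- part assigns each vertex to one of the r classes V_1..V_r;
-- an edge meets each class in exactly one vertex, so it is given as a
-- transversal  Fin r → Fin N  with  part (e i) ≡ i.
record PartiteHypergraph (r N k : ℕ) : Set where
  field
    part     : Fin N → Fin r
    edge     : Fin k → (Fin r → Fin N)
    edge-ok  : ∀ e i → part (edge e i) ≡ i
    edge-inj : ∀ e f → (∀ i → edge e i ≡ edge f i) → e ≡ f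
open PartiteHypergraph public

Meets : ∀ {r N k} → PartiteHypergraph r N k → Fin k → Fin k → Set
Meets H e f = ∃ λ i → ∃ λ j → edge H e i ≡ edge H f j

-- A set of m vertices (listed, repetitions allowed) meeting every edge.
VertexCover : ∀ {r N k} → PartiteHypergraph r N k → ℕ → Set
VertexCover {r} {N} {k} H m =
  Σ (Fin m → Fin N) λ S → ∀ (e : Fin k) → ∃ λ i → ∃ λ j → edge H e i ≡ S j

IsMin : (ℕ → Set) → ℕ → Set
IsMin P t = P t × (∀ m → P m → t ≤ m)

IsTau : ∀ {r N k} → PartiteHypergraph r N k → ℕ → Set
IsTau H = IsMin (VertexCover H)

-- An r-colouring of the edges of G (value on non-edges irrelevant).
record Colouring {n : ℕ} (G : Graph n) (r : ℕ) : Set where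
  field
    col     : Fin n → Fin n → Fin r
    col-sym : ∀ u v → col u v ≡ col v u
open Colouring public

data Reach {n r} {G : Graph n} (c : Colouring G r) (i : Fin r) : Fin n → Fin n → Set where
  here : ∀ {u} → Reach c i u u
  step : ∀ {u w v} → adj G u w ≡ true → col c u w ≡ i → Reach c i w v → Reach c i u v

-- m monochromatic components (colour, representative vertex) covering V(G).
ComponentCover : ∀ {n r} {G : Graph n} → Colouring G r → ℕ → Set
ComponentCover {n} {r} c m =
  Σ (Fin m → Fin r × Fin n) λ K →
    ∀ (w : Fin n) → ∃ λ j → Reach c (proj₁ (K j)) (proj₂ (K j)) w

CoverableBy : ∀ {n} → Graph n → ℕ → ℕ → Set
CoverableBy G r m = (c : Colouring G r) → ComponentCover c m

IsTC : ∀ {n} → Graph n → ℕ → ℕ → Set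
IsTC G r = IsMin (CoverableBy G r)

module Submission where

open import Defs hiding (sym)
open import Data.Nat using (_≤_; zero; suc; z≤n)
open import Data.Nat.Properties using (≤-trans)
open import Data.Fin using (Fin; zero; suc)
open import Data.Fin.Properties using (_≟_; ¬Fin0)
open import Data.Bool using (Bool; true; false; T; if_then_else_)
open import Data.Empty using (⊥-elim)
open import Data.Product using (∃; _,_; proj₁; proj₂)
open import Function.Bundles using (mk⇔)
open import Function.Definitions using (Surjective)
open import Relation.Nullary.Decidable using (⌊_⌋; does; isYes≗does; does-⇔; toWitness; fromWitness)
open import Relation.Binary.PropositionalEquality

-- A colouring with r colours turns every monochromatic component into a vertex
-- of H: colour the edge uv by a class i in which the hyperedges ed u and ed v
-- share their vertex. Along a path of colour i that vertex never changes, so a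
-- component of colour i with representative v sits over the vertex of ed v in
-- class i. As ed is onto, every hyperedge is ed w for some w, and the
-- component covering w yields a vertex of that hyperedge; thus m covering
-- components give a vertex cover of size m. (For r = 0 there is no colour to
-- use, but then H has no edges and τ = 0.)

firstTrue : ∀ {m} → (Fin (suc m) → Bool) → Fin (suc m)
firstTrue {zero}  p = zero
firstTrue {suc m} p = if p zero then zero else suc (firstTrue (λ i → p (suc i)))

firstTrue-cong : ∀ {m} {p q : Fin (suc m) → Bool} →
                 (∀ i → p i ≡ q i) → firstTrue p ≡ firstTrue q
firstTrue-cong {zero}  p≗q = refl
firstTrue-cong {suc m} {p} {q} p≗q rewrite p≗q zero with q zero
... | true  = refl
... | false = cong suc (firstTrue-cong (λ i → p≗q (suc i)))

firstTrue-true : ∀ {m} (p : Fin (suc m) → Bool) {i} → T (p i) → T (p (firstTrue p))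
firstTrue-true {zero}  p {zero} pi = pi
firstTrue-true {suc m} p {i} pi with p zero in p0
... | true = subst T (sym p0) _
firstTrue-true {suc m} p {zero}  pi | false = ⊥-elim (subst T p0 pi)
firstTrue-true {suc m} p {suc i} pi | false = firstTrue-true (λ i → p (suc i)) pi

Reach-preserves : ∀ {n r} {A : Set} {G : Graph n} (c : Colouring G r) (φ : Fin r → Fin n → A) →
                  (∀ {i u w} → adj G u w ≡ true → col c u w ≡ i → φ i u ≡ φ i w) →
                  ∀ {i u v} → Reach c i u v → φ i u ≡ φ i v
Reach-preserves c φ preserved here              = refl
Reach-preserves c φ preserved (step uw cuw≡i r) =
  trans (preserved uw cuw≡i) (Reach-preserves c φ preserved r)

module _ {n r N k} {G : Graph n} (H : PartiteHypergraph r N k) (ed : Fin n → Fin k) where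

  RespectsClasses : Colouring G r → Set
  RespectsClasses c = ∀ {i u w} → adj G u w ≡ true → col c u w ≡ i → edge H (ed u) i ≡ edge H (ed w) i

  componentCover⇒vertexCover : Surjective _≡_ _≡_ ed → (c : Colouring G r) → RespectsClasses c →
                               ∀ {m} → ComponentCover c m → VertexCover H m
  componentCover⇒vertexCover surj c respects {m} (K , covers) = S , meetsS
    where
    S : Fin m → Fin N
    S j = edge H (ed (proj₂ (K j))) (proj₁ (K j))

    meetsS : ∀ e → ∃ λ i → ∃ λ j → edge H e i ≡ S j
    meetsS e with surj e | covers (proj₁ (surj e))
    ... | w , ed≡e | j , reach =
      proj₁ (K j) , j ,
      trans (cong (λ f → edge H f (proj₁ (K j))) (sym (ed≡e refl)))
            (sym (Reach-preserves c (λ i u → edge H (ed u) i) respects reach))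

meets⇒sharesClass : ∀ {r N k} (H : PartiteHypergraph r N k) {e f} →
                    Meets H e f → ∃ λ i → edge H e i ≡ edge H f i
meets⇒sharesClass H {e} {f} (i , j , eᵢ≡fⱼ) = i , trans eᵢ≡fⱼ (cong (edge H f) (sym i≡j))
  where
  i≡j : i ≡ j
  i≡j = trans (sym (edge-ok H e i)) (trans (cong (part H) eᵢ≡fⱼ) (edge-ok H f j))

agreesAt : ∀ {r N} → (Fin r → Fin N) → (Fin r → Fin N) → Fin r → Bool
agreesAt x y i = ⌊ x i ≟ y i ⌋

agreesAt-sym : ∀ {r N} (x y : Fin r → Fin N) i → agreesAt x y i ≡ agreesAt y x i
agreesAt-sym x y i = begin
  ⌊ x i ≟ y i ⌋    ≡⟨ isYes≗does (x i ≟ y i) ⟩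
  does (x i ≟ y i) ≡⟨ does-⇔ (mk⇔ sym sym) (x i ≟ y i) (y i ≟ x i) ⟩
  does (y i ≟ x i) ≡⟨ isYes≗does (y i ≟ x i) ⟨
  ⌊ y i ≟ x i ⌋    ∎
  where open ≡-Reasoning

module _ {n r N k} (G : Graph n) (H : PartiteHypergraph (suc r) N k) (ed : Fin n → Fin k) where

  -- The first agreeing class, rather than an arbitrary one, keeps the colour
  -- symmetric in u and v; on non-edges the value is irrelevant.
  agreementColouring : Colouring G (suc r)
  agreementColouring = record
    { col     = λ u v → firstTrue (agreesAt (edge H (ed u)) (edge H (ed v)))
    ; col-sym = λ u v → firstTrue-cong (agreesAt-sym (edge H (ed u)) (edge H (ed v)))
    }

  agreementColouring-respects : (∀ u v → adj G u v ≡ true → Meets H (ed u) (ed v)) →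
                                RespectsClasses H ed agreementColouring
  agreementColouring-respects meet {i} {u} {w} uw refl with meets⇒sharesClass H (meet u w uw)
  ... | i₀ , agree = toWitness (firstTrue-true (agreesAt (edge H (ed u)) (edge H (ed w)))
                                               (fromWitness {a? = edge H (ed u) i₀ ≟ edge H (ed w) i₀} agree))

vertexCover⇒edgeless : ∀ {N k m} (H : PartiteHypergraph 0 N k) → VertexCover H m → VertexCover H 0
vertexCover⇒edgeless H (_ , meets) = (λ ()) , λ e → ⊥-elim (¬Fin0 (proj₁ (meets e)))

lemma3p2 : ∀ {n r N k} (G : Graph n) (H : PartiteHypergraph r N k)
             (ed : Fin n → Fin k) →
             Surjective _≡_ _≡_ ed →
             (∀ u v → adj G u v ≡ true → Meets H (ed u) (ed v)) →
             ∀ tc τ → IsTC G r tc → IsTau H τ → τ ≤ tc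
lemma3p2 {r = zero} _ H _ _ _ tc τ _ (cover , minimal) =
  ≤-trans (minimal 0 (vertexCover⇒edgeless H cover)) z≤n
lemma3p2 {r = suc r} G H ed surj meet tc τ (coverable , _) (_ , minimal) =
  minimal tc (componentCover⇒vertexCover H ed surj colouring
                (agreementColouring-respects G H ed meet) (coverable colouring))
  where
  colouring : Colouring G (suc r)
  colouring = agreementColouring G H ed
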